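{- Consider any depth-first exploration of a finite directed graph. A vertex $v$ is the leader of its strong component $C$ if and only if there is no retreating path, all of whose vertices lie in $C$, from $v$ to a vertex $w$ with $w.\mathit{pre}<v.\mathit{pre}$.
   Context: Loops and parallel arcs are allowed. Two vertices are mutually reachable if each is reachable from the other; the equivalence classes are the strong components. A depth-first exploration proceeds as follows. Initially all vertices are unvisited, all arcs untraversed, and the current vertex is null. Repeat the applicable case until all vertices are visited and all arcs are traversed: (i) The current vertex is null and some vertex is unvisited: choose any unvisited $v$, make it current and visit it; $v$ is a root. (ii) The current vertex $v$ has an untraversed exiting arc: choose any such arc $a$, from $v$ to $w$, and advance on it. If $w$ is visited, immediately retreat on $a$. Otherwise $a$ becomes a tree arc, $w$ becomes current and is visited. (iii) The current vertex $v$ has no untraversed exiting arc: if $v$ is a root, the current vertex becomes null; otherwise retreat on the tree arc entering $v$, from $u$ say, and make $u$ current. Every arc is advanced on and retreated on exactly once. The first visit of $v$ is its previsit, at time $v.\mathit{pre}$; times are ordered as the visits occur. A directed path is retreating if the exploration retreats on its arcs in the reverse of their order along the path. A path with no arcs is retreating. The leader of a strong component is its vertex with minimum $\mathit{pre}$ value. -}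

module Defs where

open import Data.Nat using (ℕ; zero; suc; _<_; _≤_)
open import Data.Fin using (Fin; _≟_)
open import Data.Bool using (Bool; true; false; if_then_else_; _∨_)
open import Data.Maybe using (Maybe; just; nothing)
open import Data.List using (List; []; _∷_; length)
open import Data.Product using (_×_; Σ)
open import Data.Unit using (⊤)
open import Relation.Nullary.Decidable using (⌊_⌋)
open import Relation.Binary.PropositionalEquality using (_≡_)

record Graph : Set where
  field
    nV   : ℕ
    nA   : ℕ
    tail : Fin nA → Fin nV
    head : Fin nA → Fin nV

module _ (G : Graph) where
  open Graph G

  Vertex : Set
  Vertex = Fin nV

  Arc : Set
  Arc = Fin nA

  data Path : Vertex → Vertex → Set where
    []  : ∀ {v} → Path v v
    step : ∀ {u w} (a : Arc) → tail a ≡ u → Path (head a) w → Path u w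

  Reachable : Vertex → Vertex → Set
  Reachable u v = Path u v

  MutuallyReachable : Vertex → Vertex → Set
  MutuallyReachable u v = Reachable u v × Reachable v u

  AllVerticesIn : (Vertex → Set) → ∀ {u w} → Path u w → Set
  AllVerticesIn P {u} []      = P u
  AllVerticesIn P {u} (step a _ p) = P u × AllVerticesIn P p

  -- Depth-first exploration, as a trace of events of a state machine.
  --   root v     : case (i), v becomes current and is visited (a root)
  --   nontree a  : case (ii), advance on a to a visited vertex and
  --                immediately retreat on a
  --   tree a     : case (ii), advance on a to an unvisited vertex
  --                (a becomes a tree arc)
  --   retreat a  : case (iii), retreat on the tree arc a entering current
  --   finish     : case (iii), current is a root; current becomes null
  data Event : Set where
    root    : Vertex → Event
    nontree : Arc → Event
    tree    : Arc → Event
    retreat : Arc → Event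
    finish  : Event

  record State : Set where
    field
      visited   : Vertex → Bool
      traversed : Arc → Bool
      current   : Maybe Vertex
      stack     : List Arc    -- tree arcs from the root to current (top = last)
  open State

  setV : (Vertex → Bool) → Vertex → Vertex → Bool
  setV f i j = if ⌊ j ≟ i ⌋ then true else f j

  setA : (Arc → Bool) → Arc → Arc → Bool
  setA f i j = if ⌊ j ≟ i ⌋ then true else f j

  initial : State
  initial = record { visited = λ _ → false ; traversed = λ _ → false
                   ; current = nothing ; stack = [] }

  Exhausted : State → Vertex → Set
  Exhausted s v = ∀ a → tail a ≡ v → traversed s a ≡ true

  data Step : State → Event → State → Set where
    step-root : ∀ s v → current s ≡ nothing → visited s v ≡ false →
      Step s (root v)
        (record s { visited = setV (visited s) v ; current = just v ; stack = [] })
    step-nontree : ∀ s a → current s ≡ just (tail a) → traversed s a ≡ false →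
      visited s (head a) ≡ true →
      Step s (nontree a) (record s { traversed = setA (traversed s) a })
    step-tree : ∀ s a → current s ≡ just (tail a) → traversed s a ≡ false →
      visited s (head a) ≡ false →
      Step s (tree a)
        (record s { traversed = setA (traversed s) a
                  ; visited = setV (visited s) (head a)
                  ; current = just (head a)
                  ; stack = a ∷ stack s })
    step-retreat : ∀ s v a rest → current s ≡ just v → Exhausted s v →
      stack s ≡ a ∷ rest →
      Step s (retreat a)
        (record s { current = just (tail a) ; stack = rest })
    step-finish : ∀ s v → current s ≡ just v → Exhausted s v → stack s ≡ [] →
      Step s finish (record s { current = nothing })

  data Run : State → List Event → State → Set where
    done : ∀ {s} → Run s [] s
    _▸_  : ∀ {s e s' es s''} → Step s e s' → Run s' es s'' → Run s (e ∷ es) s''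

  -- the exploration is complete: all vertices visited, all arcs traversed,
  -- and the current vertex is null (so every tree arc has been retreated on)
  Final : State → Set
  Final s = (∀ v → visited s v ≡ true) × (∀ a → traversed s a ≡ true)
            × current s ≡ nothing

  record Exploration : Set where
    field
      trace    : List Event
      endState : State
      run      : Run initial trace endState
      final    : Final endState

  firstIndex : (Event → Bool) → List Event → ℕ
  firstIndex p []       = 0
  firstIndex p (e ∷ es) = if p e then 0 else suc (firstIndex p es)

  visits : Vertex → Event → Bool
  visits v (root u)    = ⌊ u ≟ v ⌋
  visits v (tree a)    = ⌊ head a ≟ v ⌋
  visits v _           = false

  retreatsOn : Arc → Event → Bool
  retreatsOn a (nontree b) = ⌊ a ≟ b ⌋
  retreatsOn a (retreat b) = ⌊ a ≟ b ⌋
  retreatsOn a _           = false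

  pre : Exploration → Vertex → ℕ
  pre E v = firstIndex (visits v) (Exploration.trace E)

  retreatTime : Exploration → Arc → ℕ
  retreatTime E a = firstIndex (retreatsOn a) (Exploration.trace E)

  Retreating : Exploration → ∀ {u w} → Path u w → Set
  Retreating E [] = ⊤
  Retreating E (step a _ []) = ⊤
  Retreating E (step a e (step b e' p)) =
    retreatTime E b < retreatTime E a × Retreating E (step b e' p)

  IsLeader : Exploration → Vertex → Set
  IsLeader E v = ∀ u → MutuallyReachable u v → pre E v ≤ pre E u

-- The forward direction is immediate. Conversely, let u be in the component C of v with
-- u.pre < v.pre. Call the period during which v is on the stack the window, and a vertex new
-- if it is visited in the window. Throughout the window, every new vertex off the current
-- tree path is exhausted, and every traversed arc from a non-old vertex into C ends at a new
-- vertex. For tree arcs this is clear; a non-tree arc from the tree path to an old vertex of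
-- C is retreated on at once, before the tree arcs of the path, which are retreated on in
-- stack order, so it would complete a retreating path inside C from v to an earlier vertex.
-- Hence when the window closes, the new vertices are closed under the arcs of C, so u is new,
-- contradicting u.pre < v.pre.

module Submission where

open import Defs
open import Data.Bool using (Bool; true; false; if_then_else_)
open import Data.Bool.Properties using (not-¬; ¬-not)
open import Data.Empty using (⊥-elim)
open import Data.Fin using (Fin; _≟_)
open import Data.List using (List; []; _∷_; _++_; _∷ʳ_; length)
open import Data.List.Properties using (++-assoc)
open import Data.List.Membership.Propositional using (_∈_)
open import Data.List.Relation.Unary.All as All using (All; []; _∷_)
open import Data.List.Relation.Unary.All.Properties using (¬Any⇒All¬)
open import Data.List.Relation.Unary.AllPairs using ([]; _∷_)
open import Data.List.Relation.Unary.Any using (Any; here; there)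
open import Data.List.Relation.Unary.Linked as Linked using (Linked; []; [-]; _∷_)
open import Data.List.Relation.Unary.Unique.Propositional using (Unique)
open import Data.Maybe using (just; nothing)
open import Data.Maybe.Properties using (just-injective)
open import Data.Nat using (ℕ; suc; _+_; _<_; z≤n; s≤s; z<s)
open import Data.Nat.Properties using (+-identityʳ; m<m+n; ≤-pred; <⇒≱; ≮⇒≥)
open import Data.Product using (Σ; _×_; _,_; proj₁; proj₂)
open import Data.Sum using (_⊎_; inj₁; inj₂; [_,_])
open import Function.Base using (_on_; _∘_; id)
open import Function.Bundles using (_⇔_; mk⇔; Equivalence)
open import Relation.Nullary using (¬_; yes; no)
open import Relation.Nullary.Decidable using (⌊_⌋; isYes≗does; dec-true; dec-false)
open import Relation.Binary.PropositionalEquality using (_≡_; _≢_; refl; sym; trans; cong; subst)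

open State

module _ {n : ℕ} where

  mark : (Fin n → Bool) → Fin n → Fin n → Bool
  mark f i j = if ⌊ j ≟ i ⌋ then true else f j

  ≟-true⁻ : ∀ {i j : Fin n} → ⌊ i ≟ j ⌋ ≡ true → i ≡ j
  ≟-true⁻ {i} {j} eq with i ≟ j | eq
  ... | yes i≡j | _ = i≡j
  ... | no _    | ()

  ≟-refl : ∀ (i : Fin n) → ⌊ i ≟ i ⌋ ≡ true
  ≟-refl i = trans (isYes≗does (i ≟ i)) (dec-true (i ≟ i) refl)

  ≟-false : ∀ {i j : Fin n} → i ≢ j → ⌊ i ≟ j ⌋ ≡ false
  ≟-false {i} {j} i≢j = trans (isYes≗does (i ≟ j)) (dec-false (i ≟ j) i≢j)

  mark-self : ∀ f i → mark f i i ≡ true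
  mark-self f i rewrite ≟-refl i = refl

  mark-mono : ∀ f i {j} → f j ≡ true → mark f i j ≡ true
  mark-mono f i {j} fj with j ≟ i
  ... | yes _ = refl
  ... | no _  = fj

  mark⁻ : ∀ f i j → mark f i j ≡ true → j ≡ i ⊎ f j ≡ true
  mark⁻ f i j eq with j ≟ i
  ... | yes j≡i = inj₁ j≡i
  ... | no _    = inj₂ eq

  mark-false⁻ : ∀ f i j → mark f i j ≡ false → j ≢ i × f j ≡ false
  mark-false⁻ f i j eq with j ≟ i | eq
  ... | no j≢i | fj = j≢i , fj
  ... | yes _  | ()

module _ {A : Set} {R : A → A → Set} where

  Linked-prefix : ∀ xs {ys} → Linked R (xs ++ ys) → Linked R xs
  Linked-prefix []           _       = []
  Linked-prefix (x ∷ [])     _       = [-]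
  Linked-prefix (x ∷ y ∷ xs) (r ∷ l) = r ∷ Linked-prefix (y ∷ xs) l

  Linked-∷⁺ : ∀ {x xs} → (∀ {y} → y ∈ xs → R x y) → Linked R xs → Linked R (x ∷ xs)
  Linked-∷⁺ {xs = []}    _   _ = [-]
  Linked-∷⁺ {xs = _ ∷ _} R-x l = R-x (here refl) ∷ l

module _ {G : Graph} where

  open Graph G

  private variable
    s s' s'' t : State G
    e : Event G
    l : List (Event G)
    a b : Arc G
    x y v w : Vertex G

  firstIndex-++ : ∀ (p : Event G → Bool) {xs} ys → All (λ e → p e ≡ false) xs →
                  firstIndex G p (xs ++ ys) ≡ length xs + firstIndex G p ys
  firstIndex-++ p ys []          = refl
  firstIndex-++ p ys (px ∷ pxs) rewrite px = cong suc (firstIndex-++ p ys pxs)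

  firstIndex-hit : ∀ (p : Event G → Bool) {xs e} ys → All (λ e → p e ≡ false) xs →
                   p e ≡ true → firstIndex G p (xs ++ e ∷ ys) ≡ length xs
  firstIndex-hit p {xs} {e} ys misses hit
    rewrite firstIndex-++ p (e ∷ ys) misses | hit = +-identityʳ (length xs)

  firstIndex-miss : ∀ (p : Event G → Bool) {xs e} ys → All (λ e → p e ≡ false) xs →
                    p e ≡ false → length xs < firstIndex G p (xs ++ e ∷ ys)
  firstIndex-miss p {xs} {e} ys misses miss
    rewrite firstIndex-++ p (e ∷ ys) misses | miss = m<m+n (length xs) z<s

  firstIndex<length⇔Any : ∀ (p : Event G → Bool) {l} xs {ys} → l ≡ xs ++ ys →
                          firstIndex G p l < length xs ⇔ Any (λ e → p e ≡ true) xs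
  firstIndex<length⇔Any p {_} xs {ys} refl = mk⇔ (to xs) (from xs)
    where
    to : ∀ xs → firstIndex G p (xs ++ ys) < length xs → Any (λ e → p e ≡ true) xs
    to (x ∷ xs) lt with p x in px
    ... | true  = here px
    ... | false = there (to xs (≤-pred lt))
    from : ∀ xs → Any (λ e → p e ≡ true) xs → firstIndex G p (xs ++ ys) < length xs
    from (x ∷ xs) (here px) rewrite px = s≤s z≤n
    from (x ∷ xs) (there any) with p x
    ... | true  = s≤s z≤n
    ... | false = s≤s (from xs any)

  _++ₚ_ : Path G x y → Path G y w → Path G x w
  []           ++ₚ q = q
  step a eq p ++ₚ q = step a eq (p ++ₚ q)

  AllVerticesIn-first : ∀ {P} (p : Path G x w) → AllVerticesIn G P p → P x
  AllVerticesIn-first []             Px         = Px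
  AllVerticesIn-first (step _ _ _) (Px , _) = Px

  AllVerticesIn-last : ∀ {P} (p : Path G x w) → AllVerticesIn G P p → P w
  AllVerticesIn-last []             Pw        = Pw
  AllVerticesIn-last (step _ _ p) (_ , all) = AllVerticesIn-last p all

  visited-step⁺ : Step G s e s' → visited s x ≡ true ⊎ visits G x e ≡ true → visited s' x ≡ true
  visited-step⁺ (step-root s u _ _)          (inj₁ vis) = mark-mono (visited s) u vis
  visited-step⁺ (step-root s u _ _)          (inj₂ hit) with refl ← ≟-true⁻ hit = mark-self (visited s) u
  visited-step⁺ (step-nontree _ _ _ _ _)     (inj₁ vis) = vis
  visited-step⁺ (step-tree s b _ _ _)        (inj₁ vis) = mark-mono (visited s) (head b) vis
  visited-step⁺ (step-tree s b _ _ _)        (inj₂ hit) with refl ← ≟-true⁻ hit =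
    mark-self (visited s) (head b)
  visited-step⁺ (step-retreat _ _ _ _ _ _ _) (inj₁ vis) = vis
  visited-step⁺ (step-finish _ _ _ _ _)      (inj₁ vis) = vis

  visited-step⁻ : Step G s e s' → visited s' x ≡ true → visited s x ≡ true ⊎ visits G x e ≡ true
  visited-step⁻ (step-root s u _ _) vis with mark⁻ (visited s) u _ vis
  ... | inj₁ refl = inj₂ (≟-refl u)
  ... | inj₂ vis₀ = inj₁ vis₀
  visited-step⁻ (step-nontree _ _ _ _ _) vis = inj₁ vis
  visited-step⁻ (step-tree s b _ _ _) vis with mark⁻ (visited s) (head b) _ vis
  ... | inj₁ refl = inj₂ (≟-refl (head b))
  ... | inj₂ vis₀ = inj₁ vis₀
  visited-step⁻ (step-retreat _ _ _ _ _ _ _) vis = inj₁ vis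
  visited-step⁻ (step-finish _ _ _ _ _) vis = inj₁ vis

  newly-visited : Step G s e s' → visited s x ≡ false → visited s' x ≡ true → visits G x e ≡ true
  newly-visited stp unv vis =
    [ (λ vis₀ → ⊥-elim (not-¬ vis₀ unv)) , id ] (visited-step⁻ stp vis)

  visits-current : Step G s e s' → visits G x e ≡ true → current s' ≡ just x
  visits-current (step-root _ _ _ _)   hit = cong just (≟-true⁻ hit)
  visits-current (step-tree _ _ _ _ _) hit = cong just (≟-true⁻ hit)

  record Invariant (s : State G) : Set where
    field
      idle-stack             : current s ≡ nothing → stack s ≡ []
      current-visited        : ∀ {x} → current s ≡ just x → visited s x ≡ true
      traversed-tail-visited : ∀ {a} → traversed s a ≡ true → visited s (tail a) ≡ true
      stack-traversed        : ∀ {a} → a ∈ stack s → traversed s a ≡ true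
      stack-unique           : Unique (stack s)
  open Invariant

  invariant-initial : Invariant (initial G)
  invariant-initial = record
    { idle-stack = λ _ → refl ; current-visited = λ () ; traversed-tail-visited = λ ()
    ; stack-traversed = λ () ; stack-unique = [] }

  untraversed-∉-stack : Invariant s → traversed s a ≡ false → ¬ a ∈ stack s
  untraversed-∉-stack inv unt a∈ = not-¬ (stack-traversed inv a∈) unt

  traversed-tail-visited-before : Invariant s → Step G s e s' → traversed s' a ≡ true →
                                  visited s (tail a) ≡ true
  traversed-tail-visited-before inv (step-root _ _ _ _) t = traversed-tail-visited inv t
  traversed-tail-visited-before inv (step-nontree s b refl _ _) t =
    [ (λ { refl → current-visited inv refl }) , traversed-tail-visited inv ] (mark⁻ (traversed s) b _ t)
  traversed-tail-visited-before inv (step-tree s b refl _ _) t =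
    [ (λ { refl → current-visited inv refl }) , traversed-tail-visited inv ] (mark⁻ (traversed s) b _ t)
  traversed-tail-visited-before inv (step-retreat _ _ _ _ _ _ _) t = traversed-tail-visited inv t
  traversed-tail-visited-before inv (step-finish _ _ _ _ _) t = traversed-tail-visited inv t

  invariant-step : Invariant s → Step G s e s' → Invariant s'
  invariant-step inv stp@(step-root s u _ _) = record
    { idle-stack = λ ()
    ; current-visited = λ { refl → mark-self (visited s) u }
    ; traversed-tail-visited = λ t → visited-step⁺ stp (inj₁ (traversed-tail-visited-before inv stp t))
    ; stack-traversed = λ ()
    ; stack-unique = [] }
  invariant-step inv stp@(step-nontree s b _ _ _) = record
    { idle-stack = idle-stack inv
    ; current-visited = current-visited inv
    ; traversed-tail-visited = traversed-tail-visited-before inv stp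
    ; stack-traversed = mark-mono (traversed s) b ∘ stack-traversed inv
    ; stack-unique = stack-unique inv }
  invariant-step inv stp@(step-tree s b _ unt _) = record
    { idle-stack = λ ()
    ; current-visited = λ { refl → mark-self (visited s) (head b) }
    ; traversed-tail-visited = λ t → visited-step⁺ stp (inj₁ (traversed-tail-visited-before inv stp t))
    ; stack-traversed = λ { (here refl) → mark-self (traversed s) b
                          ; (there a∈) → mark-mono (traversed s) b (stack-traversed inv a∈) }
    ; stack-unique = All.tabulate (λ { a∈ refl → untraversed-∉-stack inv unt a∈ }) ∷ stack-unique inv }
  invariant-step inv (step-retreat s _ a rest _ _ refl) with stack-unique inv
  ... | _ ∷ rest-unique = record
    { idle-stack = λ ()
    ; current-visited = λ { refl → traversed-tail-visited inv (stack-traversed inv (here refl)) }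
    ; traversed-tail-visited = traversed-tail-visited inv
    ; stack-traversed = stack-traversed inv ∘ there
    ; stack-unique = rest-unique }
  invariant-step inv (step-finish _ _ _ _ emptied) = record
    { idle-stack = λ _ → emptied
    ; current-visited = λ ()
    ; traversed-tail-visited = traversed-tail-visited inv
    ; stack-traversed = stack-traversed inv
    ; stack-unique = stack-unique inv }

  Pending : State G → Arc G → Set
  Pending s a = traversed s a ≡ false ⊎ a ∈ stack s

  Unretreated : List (Event G) → Arc G → Set
  Unretreated l a = All (λ e → retreatsOn G a e ≡ false) l

  pending-step : Invariant s → Step G s e s' → Pending s' a →
                 Pending s a × retreatsOn G a e ≡ false
  pending-step inv (step-root _ _ _ _) (inj₁ unt) = inj₁ unt , refl
  pending-step inv (step-nontree s b _ _ _) (inj₁ unt) with mark-false⁻ (traversed s) b _ unt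
  ... | a≢b , unt₀ = inj₁ unt₀ , ≟-false a≢b
  pending-step inv (step-nontree _ b _ unt-b _) (inj₂ a∈) =
    inj₂ a∈ , ≟-false (λ { refl → untraversed-∉-stack inv unt-b a∈ })
  pending-step inv (step-tree s b _ _ _) (inj₁ unt) =
    inj₁ (proj₂ (mark-false⁻ (traversed s) b _ unt)) , refl
  pending-step inv (step-tree _ _ _ unt-b _) (inj₂ (here refl)) = inj₁ unt-b , refl
  pending-step inv (step-tree _ _ _ _ _) (inj₂ (there a∈)) = inj₂ a∈ , refl
  pending-step inv (step-retreat _ _ b _ _ _ refl) (inj₁ unt) =
    inj₁ unt , ≟-false (λ { refl → untraversed-∉-stack inv unt (here refl) })
  pending-step inv (step-retreat _ _ b _ _ _ refl) (inj₂ a∈) with stack-unique inv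
  ... | b∉ ∷ _ = inj₂ (there a∈) , ≟-false (λ { refl → All.lookup b∉ a∈ refl })
  pending-step inv (step-finish _ _ _ _ _) p = p , refl

  _▸ʳ_ : Run G s l s' → Step G s' e s'' → Run G s (l ∷ʳ e) s''
  done        ▸ʳ stp = stp ▸ done
  (stp₀ ▸ ρ) ▸ʳ stp = stp₀ ▸ (ρ ▸ʳ stp)

  invariant-run : Invariant s → Run G s l s' → Invariant s'
  invariant-run inv done       = inv
  invariant-run inv (stp ▸ ρ) = invariant-run (invariant-step inv stp) ρ

  reachable-invariant : Run G (initial G) l s → Invariant s
  reachable-invariant = invariant-run invariant-initial

  pending-run : Invariant s → Run G s l s' → Pending s' a → Pending s a × Unretreated l a
  pending-run inv done p = p , []
  pending-run inv (stp ▸ ρ) p with pending-run (invariant-step inv stp) ρ p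
  ... | p₁ , later with pending-step inv stp p₁
  ... | p₀ , now = p₀ , now ∷ later

  unretreated : Run G (initial G) l s → Pending s a → Unretreated l a
  unretreated ρ p = proj₂ (pending-run invariant-initial ρ p)

  visited-run⁺ : Run G s l s' → visited s x ≡ true ⊎ Any (λ e → visits G x e ≡ true) l →
                 visited s' x ≡ true
  visited-run⁺ done       (inj₁ vis)         = vis
  visited-run⁺ (stp ▸ ρ) (inj₁ vis)         = visited-run⁺ ρ (inj₁ (visited-step⁺ stp (inj₁ vis)))
  visited-run⁺ (stp ▸ ρ) (inj₂ (here hit))  = visited-run⁺ ρ (inj₁ (visited-step⁺ stp (inj₂ hit)))
  visited-run⁺ (stp ▸ ρ) (inj₂ (there any)) = visited-run⁺ ρ (inj₂ any)

  visited-run⁻ : Run G s l s' → visited s' x ≡ true →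
                 visited s x ≡ true ⊎ Any (λ e → visits G x e ≡ true) l
  visited-run⁻ done vis = inj₁ vis
  visited-run⁻ (stp ▸ ρ) vis with visited-run⁻ ρ vis
  ... | inj₂ any = inj₂ (there any)
  ... | inj₁ vis₁ with visited-step⁻ stp vis₁
  ...   | inj₁ vis₀ = inj₁ vis₀
  ...   | inj₂ hit  = inj₂ (here hit)

  visited⇔visits : Run G (initial G) l s → visited s x ≡ true ⇔ Any (λ e → visits G x e ≡ true) l
  visited⇔visits ρ =
    mk⇔ (λ vis → [ (λ ()) , id ] (visited-run⁻ ρ vis)) (visited-run⁺ ρ ∘ inj₂)

  unvisited⇒unvisits : Run G (initial G) l s → visited s x ≡ false →
                       All (λ e → visits G x e ≡ false) l
  unvisited⇒unvisits {l = l} ρ unv =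
    All.map ¬-not (¬Any⇒All¬ l (λ any → not-¬ (Equivalence.from (visited⇔visits ρ) any) unv))

  record FirstVisit (v : Vertex G) (l : List (Event G)) (s t : State G) : Set where
    field
      {s₀ s₁}       : State G
      past          : List (Event G)
      event         : Event G
      future        : List (Event G)
      splits        : l ≡ past ++ event ∷ future
      run-past      : Run G s past s₀
      visiting-step : Step G s₀ event s₁
      run-future    : Run G s₁ future t
      unvisited     : visited s₀ v ≡ false
      visits-v      : visits G v event ≡ true

  first-visit : Run G s l t → visited s v ≡ false → visited t v ≡ true → FirstVisit v l s t
  first-visit done unv vis = ⊥-elim (not-¬ vis unv)
  first-visit {v = v} (_▸_ {s' = s'} stp ρ) unv vis with visited s' v in vis'
  ... | true = record
    { past = [] ; splits = refl ; run-past = done ; visiting-step = stp ; run-future = ρ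
    ; unvisited = unv ; visits-v = newly-visited stp unv vis' }
  ... | false = record
    { past = _ ∷ past ; splits = cong (_ ∷_) splits ; run-past = stp ▸ run-past
    ; visiting-step = visiting-step ; run-future = run-future ; unvisited = unvisited ; visits-v = visits-v }
    where open FirstVisit (first-visit ρ vis' vis)

RetreatsToEarlier : {G : Graph} → Exploration G → Vertex G → Set
RetreatsToEarlier {G} E v =
  Σ (Vertex G) λ w → Σ (Path G v w) λ p →
    AllVerticesIn G (λ x → MutuallyReachable G x v) p × Retreating G E p × pre G E w < pre G E v

module _ {G : Graph} (E : Exploration G) where

  open Exploration E
  open Invariant

  private variable
    s s' : State G
    e : Event G
    pfx r : List (Event G)
    a b : Arc G

  RetreatOrdered : List (Arc G) → Set
  RetreatOrdered = Linked (_<_ on retreatTime G E)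

  split-∷ʳ : trace ≡ pfx ++ e ∷ r → trace ≡ (pfx ∷ʳ e) ++ r
  split-∷ʳ {pfx} {e} {r} split = trans split (sym (++-assoc pfx (e ∷ []) r))

  retreated-now-first : trace ≡ pfx ++ e ∷ r → Run G (initial G) pfx s → Step G s e s' →
                        Pending s b → retreatsOn G b e ≡ true → Pending s' a →
                        retreatTime G E b < retreatTime G E a
  retreated-now-first {pfx} {e} {r} {s} {b = b} {a = a} split ρ stp pending-b hit pending-a =
    subst (_< retreatTime G E a) (sym now) later
    where
    a-survives : Pending s a × retreatsOn G a e ≡ false
    a-survives = pending-step (reachable-invariant ρ) stp pending-a
    now : retreatTime G E b ≡ length pfx
    now = trans (cong (firstIndex G (retreatsOn G b)) split)
                (firstIndex-hit (retreatsOn G b) r (unretreated ρ pending-b) hit)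
    later : length pfx < retreatTime G E a
    later = subst (length pfx <_) (sym (cong (firstIndex G (retreatsOn G a)) split))
                  (firstIndex-miss (retreatsOn G a) r (unretreated ρ (proj₁ a-survives))
                                   (proj₂ a-survives))

  stack-ordered : trace ≡ pfx ++ r → Run G (initial G) pfx s → Run G s r endState →
                  RetreatOrdered (stack s)
  stack-ordered _ ρ done rewrite idle-stack (reachable-invariant ρ) (proj₂ (proj₂ final)) = []
  stack-ordered _ ρ (step-root _ _ idle _ ▸ _) rewrite idle-stack (reachable-invariant ρ) idle = []
  stack-ordered _ _ (step-finish _ _ _ _ refl ▸ _) = []
  stack-ordered split ρ (stp@(step-nontree _ _ _ _ _) ▸ ρ') =
    stack-ordered (split-∷ʳ split) (ρ ▸ʳ stp) ρ'
  stack-ordered split ρ (stp@(step-tree _ _ _ _ _) ▸ ρ') =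
    Linked.tail (stack-ordered (split-∷ʳ split) (ρ ▸ʳ stp) ρ')
  stack-ordered split ρ (stp@(step-retreat _ _ a _ _ _ refl) ▸ ρ') =
    Linked-∷⁺ (λ a∈ → retreated-now-first split ρ stp (inj₂ (here refl)) (≟-refl a) (inj₂ a∈))
              (stack-ordered (split-∷ʳ split) (ρ ▸ʳ stp) ρ')

  nontree-ordered : trace ≡ pfx ++ nontree b ∷ r → Run G (initial G) pfx s →
                    Step G s (nontree b) s' → Run G s' r endState → RetreatOrdered (b ∷ stack s)
  nontree-ordered split ρ stp@(step-nontree _ b _ unt _) ρ' =
    Linked-∷⁺ (λ a∈ → retreated-now-first split ρ stp (inj₁ unt) (≟-refl b) (inj₂ a∈))
              (stack-ordered (split-∷ʳ split) (ρ ▸ʳ stp) ρ')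

-- old marks the vertices visited before v, and base is the stack at the previsit of v.
module Window {G : Graph} (E : Exploration G) (v : Vertex G) (old : Vertex G → Bool)
              (base : List (Arc G)) where

  open Graph G
  open Exploration E

  private variable
    s s' : State G
    pfx r : List (Event G)
    a b : Arc G
    x y w c : Vertex G
    ts : List (Arc G)

  InC : Vertex G → Set
  InC x = MutuallyReachable G x v

  record New (seen : Vertex G → Bool) (y : Vertex G) : Set where
    constructor _,_
    field
      now-visited : seen y ≡ true
      not-old     : old y ≡ false

  NewClosed : State G → Set
  NewClosed s = ∀ {a} → traversed s a ≡ true → old (tail a) ≡ false → InC (head a) →
                 New (visited s) (head a)

  record Closed (s : State G) : Set where
    field
      v-new         : New (visited s) v
      new-exhausted : ∀ {y} → New (visited s) y → Exhausted G s y
      new-closed    : NewClosed s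

  new-spreads : Closed s → Path G v x → Path G x y → Path G y v →
                New (visited s) x → New (visited s) y
  new-spreads c vx []              yv new = new
  new-spreads c vx (step a refl q) yv new =
    new-spreads c (vx ++ₚ step a refl []) q yv
      (Closed.new-closed c (Closed.new-exhausted c new a refl) (New.not-old new)
                           (q ++ₚ yv , vx ++ₚ step a refl []))

  closed-contains-component : Closed s → InC x → New (visited s) x
  closed-contains-component c (xv , vx) = new-spreads c [] vx xv (Closed.v-new c)

  -- The arcs of a tree path from v are listed last arc first, as on the stack.
  data TreePath : List (Arc G) → Vertex G → Set where
    []   : TreePath [] v
    push : ∀ (a : Arc G) → tail a ≡ c → TreePath ts c → TreePath (a ∷ ts) (head a)

  _++ᵗ_ : TreePath ts c → Path G c w → Path G v w
  []             ++ᵗ q = q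
  push a eq path ++ᵗ q = path ++ᵗ step a eq q

  OnTreePath : Vertex G → TreePath ts c → Set
  OnTreePath y []             = y ≡ v
  OnTreePath y (push a _ path) = y ≡ head a ⊎ OnTreePath y path

  ++ᵗ-InC : (path : TreePath ts c) (q : Path G c w) → AllVerticesIn G InC q →
            AllVerticesIn G InC (path ++ᵗ q)
  ++ᵗ-InC []               q inC = inC
  ++ᵗ-InC (push a eq path) q inC =
    ++ᵗ-InC path (step a eq q) ((step a eq (proj₁ (AllVerticesIn-first q inC)) , path ++ᵗ []) , inC)

  ++ᵗ-retreating : (path : TreePath ts c) (eq : tail b ≡ c) (q : Path G (head b) w) →
                   Retreating G E (step b eq q) → RetreatOrdered E (b ∷ ts) →
                   Retreating G E (path ++ᵗ step b eq q)
  ++ᵗ-retreating []                eq q retreating _                 = retreating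
  ++ᵗ-retreating (push a eq' path) eq q retreating (b-before-a ∷ ordered) =
    ++ᵗ-retreating path eq' (step _ eq q) (b-before-a , retreating) ordered

  tree-path-escape : TreePath ts (tail b) → RetreatOrdered E (b ∷ ts) → InC (head b) →
                     pre G E (head b) < pre G E v → RetreatsToEarlier E v
  tree-path-escape {b = b} path ordered inC earlier =
    head b , path ++ᵗ arc , ++ᵗ-InC path arc ((step b refl (proj₁ inC) , path ++ᵗ []) , inC) ,
    ++ᵗ-retreating path refl [] _ ordered , earlier
    where
    arc : Path G (tail b) (head b)
    arc = step b refl []

  record Open (s : State G) : Set where
    constructor window
    field
      {top}              : List (Arc G)
      {tip}              : Vertex G
      tree-path          : TreePath top tip
      stack-split        : stack s ≡ top ++ base
      at-tip             : current s ≡ just tip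
      v-new              : New (visited s) v
      old-visited        : ∀ {y} → old y ≡ true → visited s y ≡ true
      off-path-exhausted : ∀ {y} → New (visited s) y → ¬ OnTreePath y tree-path → Exhausted G s y
      new-closed         : NewClosed s

  close : New (visited s) v → (∀ {y} → New (visited s) y → ¬ y ≡ v → Exhausted G s y) →
          NewClosed s → Exhausted G s v → Closed s
  close {s = s} new-v off closed exhausted-v = record
    { v-new = new-v ; new-exhausted = all-exhausted ; new-closed = closed }
    where
    all-exhausted : ∀ {y} → New (visited s) y → Exhausted G s y
    all-exhausted {y} new with y ≟ v
    ... | yes refl = exhausted-v
    ... | no y≢v   = off new y≢v

  open-tree : Open s → Step G s (tree b) s' → Open s'
  open-tree {s' = s'} (window path refl refl (vis-v , old-v) old-vis off closed)
            (step-tree s b refl _ unvis) =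
    window (push b refl path) refl refl (mark-mono (visited s) (head b) vis-v , old-v)
           (mark-mono (visited s) (head b) ∘ old-vis) off' closed'
    where
    off' : ∀ {y} → New (visited s') y → ¬ (y ≡ head b ⊎ OnTreePath y path) → Exhausted G s' y
    off' {y} (vis , fresh) ¬on with mark⁻ (visited s) (head b) y vis
    ... | inj₁ y≡hb = ⊥-elim (¬on (inj₁ y≡hb))
    ... | inj₂ vis₀ = λ a eq → mark-mono (traversed s) b (off (vis₀ , fresh) (¬on ∘ inj₂) a eq)
    closed' : NewClosed s'
    closed' {a} t fresh-tail inC with mark⁻ (traversed s) b a t
    ... | inj₁ refl = mark-self (visited s) (head b) , ¬-not (λ old-hb → not-¬ (old-vis old-hb) unvis)
    ... | inj₂ t₀   with closed t₀ fresh-tail inC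
    ...   | vis₀ , fresh = mark-mono (visited s) (head b) vis₀ , fresh

  open-retreat : Open s → Step G s (retreat a) s' → Open s' ⊎ Closed s
  open-retreat (window [] refl refl new-v _ off closed) (step-retreat _ _ _ _ refl exhausted _) =
    inj₂ (close new-v off closed exhausted)
  open-retreat {s = s} (window (push e refl path) refl refl new-v old-vis off closed)
                       (step-retreat _ _ _ _ refl exhausted refl) =
    inj₁ (window path refl refl new-v old-vis off' closed)
    where
    off' : ∀ {y} → New (visited s) y → ¬ OnTreePath y path → Exhausted G s y
    off' {y} new ¬on with y ≟ head e
    ... | yes refl = exhausted
    ... | no y≢he  = off new [ y≢he , ¬on ]

  open-finish : Open s → Step G s finish s' → Closed s
  open-finish (window [] refl refl new-v _ off closed) (step-finish _ _ refl exhausted _) =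
    close new-v off closed exhausted
  open-finish (window (push _ _ _) refl _ _ _ _ _) (step-finish _ _ _ _ ())

  module _ (no-escape : ¬ RetreatsToEarlier E v)
           (old-earlier : ∀ {x} → old x ≡ true → pre G E x < pre G E v) where

    open-nontree : RetreatOrdered E (b ∷ stack s) → Open s → Step G s (nontree b) s' → Open s'
    open-nontree {s' = s'} ordered (window path refl refl new-v old-vis off closed)
                 (step-nontree s b refl _ vis-hb) =
      window path refl refl new-v old-vis
             (λ new ¬on a eq → mark-mono (traversed s) b (off new ¬on a eq)) closed'
      where
      closed' : NewClosed s'
      closed' {a} t fresh-tail inC with mark⁻ (traversed s) b a t
      ... | inj₂ t₀   = closed t₀ fresh-tail inC
      ... | inj₁ refl = vis-hb , ¬-not (λ old-hb →
        no-escape (tree-path-escape path (Linked-prefix (b ∷ _) ordered) inC (old-earlier old-hb)))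

    window-closes : trace ≡ pfx ++ r → Run G (initial G) pfx s → Run G s r endState → Open s →
                    Σ (State G) Closed
    window-closes _ _ done (window _ _ refl _ _ _ _) with () ← proj₂ (proj₂ final)
    window-closes _ _ (step-root _ _ () _ ▸ _) (window _ _ refl _ _ _ _)
    window-closes split ρ (stp@(step-nontree _ _ _ _ _) ▸ ρ') w =
      window-closes (split-∷ʳ E split) (ρ ▸ʳ stp) ρ'
                    (open-nontree (nontree-ordered E split ρ stp ρ') w stp)
    window-closes split ρ (stp@(step-tree _ _ _ _ _) ▸ ρ') w =
      window-closes (split-∷ʳ E split) (ρ ▸ʳ stp) ρ' (open-tree w stp)
    window-closes split ρ (stp@(step-retreat _ _ _ _ _ _ _) ▸ ρ') w with open-retreat w stp
    ... | inj₁ w'     = window-closes (split-∷ʳ E split) (ρ ▸ʳ stp) ρ' w'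
    ... | inj₂ closed = _ , closed
    window-closes _ _ (stp@(step-finish _ _ _ _ _) ▸ _) w = _ , open-finish w stp

module _ {G : Graph} (E : Exploration G) where

  open Exploration E
  open Invariant

  window-start : ∀ {l s₀ e s₁ v} → Run G (initial G) l s₀ → Step G s₀ e s₁ →
                 visits G v e ≡ true → visited s₀ v ≡ false →
                 Window.Open E v (visited s₀) (stack s₁) s₁
  window-start {s₀ = s₀} {s₁ = s₁} {v = v} ρ stp hit unv =
    window [] refl at-v (current-visited inv₁ at-v , unv) (visited-step⁺ stp ∘ inj₁) off closed
    where
    open Window E v (visited s₀) _
    inv₀ : Invariant s₀
    inv₀ = reachable-invariant ρ
    inv₁ : Invariant s₁
    inv₁ = invariant-step inv₀ stp
    at-v : current s₁ ≡ just v
    at-v = visits-current stp hit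
    off : ∀ {y} → New (visited s₁) y → ¬ y ≡ v → Exhausted G s₁ y
    off (vis , unv-y) y≢v =
      ⊥-elim (y≢v (just-injective (trans (sym (visits-current stp (newly-visited stp unv-y vis))) at-v)))
    closed : NewClosed s₁
    closed t unv-tail = ⊥-elim (not-¬ (traversed-tail-visited-before inv₀ stp t) unv-tail)

  no-earlier-member : ∀ {u v} → ¬ RetreatsToEarlier E v → MutuallyReachable G u v →
                      ¬ pre G E u < pre G E v
  no-earlier-member {u} {v} no-escape u~v u<v =
    not-¬ (earlier⇒old u<v) (New.not-old (closed-contains-component (proj₂ closes) u~v))
    where
    open FirstVisit (first-visit run refl (proj₁ final v))
    open Window E v (visited s₀) (stack s₁)
    pre-v : pre G E v ≡ length past
    pre-v = trans (cong (firstIndex G (visits G v)) splits)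
                  (firstIndex-hit (visits G v) future (unvisited⇒unvisits run-past unvisited) visits-v)
    earlier⇔visits : ∀ {x} → pre G E x < pre G E v ⇔ Any (λ e → visits G x e ≡ true) past
    earlier⇔visits {x} rewrite pre-v = firstIndex<length⇔Any (visits G x) past splits
    earlier⇒old : ∀ {x} → pre G E x < pre G E v → visited s₀ x ≡ true
    earlier⇒old = Equivalence.from (visited⇔visits run-past) ∘ Equivalence.to earlier⇔visits
    old⇒earlier : ∀ {x} → visited s₀ x ≡ true → pre G E x < pre G E v
    old⇒earlier = Equivalence.from earlier⇔visits ∘ Equivalence.to (visited⇔visits run-past)
    closes : Σ (State G) Closed
    closes = window-closes no-escape old⇒earlier (split-∷ʳ E splits) (run-past ▸ʳ visiting-step)
               run-future (window-start run-past visiting-step visits-v unvisited)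

lemma12 : (G : Graph) (E : Exploration G) (v : Vertex G) →
    IsLeader G E v ⇔
      (¬ (Σ (Vertex G) λ w → Σ (Path G v w) λ p →
           AllVerticesIn G (λ x → MutuallyReachable G x v) p
           × Retreating G E p
           × pre G E w < pre G E v))
lemma12 G E v = mk⇔
  (λ leader (w , p , inC , _ , w<v) → <⇒≱ w<v (leader w (AllVerticesIn-last p inC)))
  (λ no-escape u u~v → ≮⇒≥ (no-earlier-member E no-escape u~v))
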